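{- Let $A\in I(k,l)$ and $v\in a_{k,l}(n)$, and let $P_A^1,\dots,P_A^{s_A}$ be the tableaux after each insertion step in the $A$-RSK formation of $P_A$ from $v$. For every $p\in\{2,\dots,s_A\}$ and all $r,s\ge1$: if $c(r,s)$ contains some letter $w$ in $P_A^{p-1}$, then $c(r,s)$ contains some letter $z\le_A w$ in $P_A^p$. Conversely, if $c(r,s)$ contains some letter $z$ in $P_A^p$, then in $P_A^{p-1}$ the cell $c(r,s)$ was either empty or contained some letter $w\ge_A z$.
   Context: Let $t_1,\dots,t_k,u_1,\dots,u_l$ be distinct symbols ("$t$-letters" and "$u$-letters"). A shuffle is a total order $<_A$ with $t_1<_A\cdots<_A t_k$ and $u_1<_A\cdots<_A u_l$; $I(k,l)$ is the set of shuffles. $a_{k,l}(n)$ is the set of words of length $n$ in these letters. $c(i,j)$ is the cell in row $i$, column $j$ (English convention). $A$-RSK insertion of a letter $x$ proceeds in steps, each step inserting one letter $y$ into a row or column: initially $x$ is inserted into row 1 if a $t$-letter, into column 1 if a $u$-letter. Inserting a $t$-letter $y$ into row $r$: $y$ bumps the leftmost entry of row $r$ strictly $A$-greater than $y$, or if none, is placed in a new cell at the end of row $r$. Inserting a $u$-letter $y$ into column $c$: $y$ bumps the topmost entry of column $c$ strictly $A$-greater than $y$, or if none, is placed in a new cell at the bottom of column $c$. An entry bumped from $c(i,j)$ is next inserted into row $i+1$ if a $t$-letter, into column $j+1$ if a $u$-letter; insertion ends when a new cell is created. $P_A$ is formed by inserting $v_1,\dots,v_n$ successively into the empty tableau; $s_A$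 is the total number of insertion steps performed, and $P_A^p$ denotes the tableau immediately after the $p$-th step. -}

module Defs where

open import Data.Nat using (ℕ; zero; suc; _<_; _≤_; _<ᵇ_; _≡ᵇ_; _⊔_)
open import Data.Fin using (Fin) renaming (_<_ to _<ᶠ_)
open import Data.Bool using (Bool; true; false; if_then_else_; _∧_)
open import Data.Maybe using (Maybe; just; nothing)
open import Data.List using (List; []; _∷_; map)
open import Data.Vec using (Vec; toList)
open import Data.Product using (_×_; _,_; proj₁)
open import Data.Empty using (⊥)
open import Relation.Nullary using (¬_)
open import Relation.Binary.PropositionalEquality using (_≡_)

data Letter (k l : ℕ) : Set where
  t : Fin k → Letter k l
  u : Fin l → Letter k l

-- A (strict) total order on
-- a finite set is encoded by an injective rank function into ℕ:
-- x <_A y  iff  rank x < rank y.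
record Shuffle (k l : ℕ) : Set where
  field
    rank           : Letter k l → ℕ
    rank-injective : ∀ {x y} → rank x ≡ rank y → x ≡ y
    t-increasing   : ∀ {i j : Fin k} → i <ᶠ j → rank (t i) < rank (t j)
    u-increasing   : ∀ {i j : Fin l} → i <ᶠ j → rank (u i) < rank (u j)

open Shuffle public

_<[_]_ : ∀ {k l} → Letter k l → Shuffle k l → Letter k l → Set
x <[ A ] y = rank A x < rank A y

-- x ≤_A y  (reflexive closure of <_A; equivalent since rank is injective)
_≤[_]_ : ∀ {k l} → Letter k l → Shuffle k l → Letter k l → Set
x ≤[ A ] y = rank A x ≤ rank A y

ltᵇ : ∀ {k l} → Shuffle k l → Letter k l → Letter k l → Bool
ltᵇ A x y = rank A x <ᵇ rank A y

-- Tableaux: a finite list of filled cells (row i, column j, entry),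
-- rows and columns numbered from 1 (English convention).  The cells in
-- the list are distinct (new cells are only ever created at empty
-- positions).

Tableau : ℕ → ℕ → Set
Tableau k l = List (ℕ × ℕ × Letter k l)

entry : ∀ {k l} → Tableau k l → ℕ → ℕ → Maybe (Letter k l)
entry [] i j = nothing
entry ((a , b , x) ∷ T) i j =
  if (a ≡ᵇ i) ∧ (b ≡ᵇ j) then just x else entry T i j

-- largest occupied column in row r (0 if row r is empty);
-- the end of row r is the cell c(r, maxCol T r + 1)
maxCol : ∀ {k l} → Tableau k l → ℕ → ℕ
maxCol [] r = 0
maxCol ((a , b , x) ∷ T) r = if a ≡ᵇ r then b ⊔ maxCol T r else maxCol T r

-- largest occupied row in column c (0 if column c is empty);
-- the bottom of column c is the cell c(maxRow T c + 1, c)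
maxRow : ∀ {k l} → Tableau k l → ℕ → ℕ
maxRow [] c = 0
maxRow ((a , b , x) ∷ T) c = if b ≡ᵇ c then a ⊔ maxRow T c else maxRow T c

pickMin : ∀ {k l} → ℕ → Letter k l → Maybe (ℕ × Letter k l) → Maybe (ℕ × Letter k l)
pickMin b x nothing = just (b , x)
pickMin b x (just (b' , x')) = if b' <ᵇ b then just (b' , x') else just (b , x)

leftmostGreater : ∀ {k l} → Shuffle k l → Tableau k l → ℕ → Letter k l → Maybe (ℕ × Letter k l)
leftmostGreater A [] r y = nothing
leftmostGreater A ((a , b , x) ∷ T) r y =
  if (a ≡ᵇ r) ∧ ltᵇ A y x
  then pickMin b x (leftmostGreater A T r y)
  else leftmostGreater A T r y

topmostGreater : ∀ {k l} → Shuffle k l → Tableau k l → ℕ → Letter k l → Maybe (ℕ × Letter k l)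
topmostGreater A [] c y = nothing
topmostGreater A ((a , b , x) ∷ T) c y =
  if (b ≡ᵇ c) ∧ ltᵇ A y x
  then pickMin a x (topmostGreater A T c y)
  else topmostGreater A T c y

setCell : ∀ {k l} → Tableau k l → ℕ → ℕ → Letter k l → Tableau k l
setCell [] i j y = []
setCell ((a , b , x) ∷ T) i j y =
  (if (a ≡ᵇ i) ∧ (b ≡ᵇ j) then (a , b , y) else (a , b , x)) ∷ setCell T i j y

data Task (k l : ℕ) : Set where
  intoRow : ℕ → Letter k l → Task k l
  intoCol : ℕ → Letter k l → Task k l

initTask : ∀ {k l} → Letter k l → Task k l
initTask (t i) = intoRow 1 (t i)
initTask (u i) = intoCol 1 (u i)

bumpTask : ∀ {k l} → Letter k l → ℕ → ℕ → Task k l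
bumpTask (t a) i j = intoRow (suc i) (t a)
bumpTask (u a) i j = intoCol (suc j) (u a)

step : ∀ {k l} → Shuffle k l → Tableau k l → Task k l → Tableau k l × Maybe (Task k l)
step A T (intoRow r y) with leftmostGreater A T r y
... | nothing       = ((r , suc (maxCol T r) , y) ∷ T) , nothing
... | just (j , x)  = setCell T r j y , just (bumpTask x r j)
step A T (intoCol c y) with topmostGreater A T c y
... | nothing       = ((suc (maxRow T c) , c , y) ∷ T) , nothing
... | just (i , x)  = setCell T i c y , just (bumpTask x i c)

record Config (k l : ℕ) : Set where
  constructor config
  field
    tableau : Tableau k l
    pending : Maybe (Task k l)
    rest    : List (Letter k l)

open Config public

Final : ∀ {k l} → Config k l → Set
Final c = (pending c ≡ nothing) × (rest c ≡ [])

advance : ∀ {k l} → Shuffle k l → Config k l → Config k l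
advance A (config T (just τ) w) =
  let r = step A T τ in config (proj₁ r) (Data.Product.proj₂ r) w
advance A (config T nothing (x ∷ w)) =
  let r = step A T (initTask x) in config (proj₁ r) (Data.Product.proj₂ r) w
advance A (config T nothing []) = config T nothing []

configAfter : ∀ {k l n} → Shuffle k l → Vec (Letter k l) n → ℕ → Config k l
configAfter A v zero    = config [] nothing (toList v)
configAfter A v (suc p) = advance A (configAfter A v p)

-- P_A^p : the tableau immediately after the p-th step (P_A^0 empty)
Pstep : ∀ {k l n} → Shuffle k l → Vec (Letter k l) n → ℕ → Tableau k l
Pstep A v p = tableau (configAfter A v p)

-- the p-th step is actually performed, i.e. p ≤ s_A
-- (for p ≥ 1: the process has not finished after p-1 steps)
StepPerformed : ∀ {k l n} → Shuffle k l → Vec (Letter k l) n → ℕ → Set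
StepPerformed A v zero    = ⊥
StepPerformed A v (suc q) = ¬ Final (configAfter A v q)

{-# OPTIONS --safe #-}
-- Every insertion step changes a single cell: either it bumps, replacing the
-- entry x of an occupied cell by the letter y being inserted, where y <_A x
-- by the choice of the bumped entry, or it writes y into an empty cell (the
-- end of a row or the bottom of a column).  So entries only decrease and
-- cells only appear.
module Submission where

open import Defs
open import Data.Bool using (true; false; _∧_; if_then_else_)
open import Data.List using ([]; _∷_)
open import Data.List.Membership.Propositional using (_∈_)
open import Data.List.Relation.Unary.Any using (here; there)
open import Data.Maybe using (Maybe; just; nothing)
open import Data.Nat using (ℕ; zero; suc; _≤_; _≡ᵇ_; _<ᵇ_; _≟_)
open import Data.Nat.Properties
  using (≡ᵇ⇒≡; ≡⇒≡ᵇ; <ᵇ-reflects-<; ≤-refl; ≤-trans; <⇒≤; m≤m⊔n; m≤n⊔m; 1+n≰n)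
open import Data.Product using (_×_; ∃; _,_; proj₁; map₁)
open import Data.Sum using (_⊎_; inj₁; inj₂)
open import Data.Unit using (⊤; tt)
open import Data.Vec using (Vec)
open import Relation.Nullary using (¬_; yes; no; contradiction)
open import Relation.Nullary.Decidable using (_×-dec_)
open import Relation.Nullary.Reflects using (Reflects; ofʸ; ofⁿ; fromEquivalence; _×-reflects_)
open import Relation.Binary.PropositionalEquality
  using (_≡_; refl; sym; trans; cong; subst; subst₂; module ≡-Reasoning)
open ≡-Reasoning

≡ᵇ-reflects-≡ : ∀ m n → Reflects (m ≡ n) (m ≡ᵇ n)
≡ᵇ-reflects-≡ m n = fromEquivalence (≡ᵇ⇒≡ m n) (≡⇒≡ᵇ m n)

sameCell-reflects : ∀ a b i j → Reflects ((a ≡ i) × (b ≡ j)) ((a ≡ᵇ i) ∧ (b ≡ᵇ j))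
sameCell-reflects a b i j = ≡ᵇ-reflects-≡ a i ×-reflects ≡ᵇ-reflects-≡ b j

module _ {k l : ℕ} where

  entry⇒∈ : ∀ (T : Tableau k l) {i j x} → entry T i j ≡ just x → (i , j , x) ∈ T
  entry⇒∈ ((a , b , x′) ∷ T) {i} {j} eq
    with (a ≡ᵇ i) ∧ (b ≡ᵇ j) | sameCell-reflects a b i j | eq
  ... | true  | ofʸ (refl , refl) | refl = here refl
  ... | false | _                 | eq′  = there (entry⇒∈ T eq′)

  ∈⇒≤maxCol : ∀ (T : Tableau k l) {r j x} → (r , j , x) ∈ T → j ≤ maxCol T r
  ∈⇒≤maxCol ((a , b , _) ∷ T) {r} x∈T with a ≡ᵇ r | ≡ᵇ-reflects-≡ a r | x∈T
  ... | true  | _        | here refl = m≤m⊔n b (maxCol T r)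
  ... | true  | _        | there x∈ = ≤-trans (∈⇒≤maxCol T x∈) (m≤n⊔m b (maxCol T r))
  ... | false | ofⁿ a≢r  | here refl = contradiction refl a≢r
  ... | false | _        | there x∈ = ∈⇒≤maxCol T x∈

  ∈⇒≤maxRow : ∀ (T : Tableau k l) {i c x} → (i , c , x) ∈ T → i ≤ maxRow T c
  ∈⇒≤maxRow ((a , b , _) ∷ T) {c = c} x∈T with b ≡ᵇ c | ≡ᵇ-reflects-≡ b c | x∈T
  ... | true  | _        | here refl = m≤m⊔n a (maxRow T c)
  ... | true  | _        | there x∈ = ≤-trans (∈⇒≤maxRow T x∈) (m≤n⊔m a (maxRow T c))
  ... | false | ofⁿ b≢c  | here refl = contradiction refl b≢c
  ... | false | _        | there x∈ = ∈⇒≤maxRow T x∈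

  entry-endOfRow : ∀ (T : Tableau k l) r → entry T r (suc (maxCol T r)) ≡ nothing
  entry-endOfRow T r with entry T r (suc (maxCol T r)) in eq
  ... | nothing = refl
  ... | just _  = contradiction (∈⇒≤maxCol T (entry⇒∈ T eq)) 1+n≰n

  entry-bottomOfColumn : ∀ (T : Tableau k l) c → entry T (suc (maxRow T c)) c ≡ nothing
  entry-bottomOfColumn T c with entry T (suc (maxRow T c)) c in eq
  ... | nothing = refl
  ... | just _  = contradiction (∈⇒≤maxRow T (entry⇒∈ T eq)) 1+n≰n

  pickMin-choice : ∀ b (x : Letter k l) m {p} → pickMin b x m ≡ just p → p ≡ (b , x) ⊎ m ≡ just p
  pickMin-choice b x nothing          refl = inj₁ refl
  pickMin-choice b x (just (b′ , x′)) eq with b′ <ᵇ b | eq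
  ... | true  | refl = inj₂ refl
  ... | false | refl = inj₁ refl

  leftmostGreater-sound : ∀ A (T : Tableau k l) r y {j x} →
    leftmostGreater A T r y ≡ just (j , x) → (r , j , x) ∈ T × y <[ A ] x
  leftmostGreater-sound A ((a , b , x′) ∷ T) r y eq
    with (a ≡ᵇ r) ∧ ltᵇ A y x′
       | ≡ᵇ-reflects-≡ a r ×-reflects <ᵇ-reflects-< (rank A y) (rank A x′) | eq
  ... | false | _                 | eq′ = map₁ there (leftmostGreater-sound A T r y eq′)
  ... | true  | ofʸ (refl , y<x′) | eq′ with pickMin-choice b x′ (leftmostGreater A T r y) eq′
  ...   | inj₁ refl = here refl , y<x′
  ...   | inj₂ eq″  = map₁ there (leftmostGreater-sound A T r y eq″)

  topmostGreater-sound : ∀ A (T : Tableau k l) c y {i x} →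
    topmostGreater A T c y ≡ just (i , x) → (i , c , x) ∈ T × y <[ A ] x
  topmostGreater-sound A ((a , b , x′) ∷ T) c y eq
    with (b ≡ᵇ c) ∧ ltᵇ A y x′
       | ≡ᵇ-reflects-≡ b c ×-reflects <ᵇ-reflects-< (rank A y) (rank A x′) | eq
  ... | false | _                 | eq′ = map₁ there (topmostGreater-sound A T c y eq′)
  ... | true  | ofʸ (refl , y<x′) | eq′ with pickMin-choice a x′ (topmostGreater A T c y) eq′
  ...   | inj₁ refl = here refl , y<x′
  ...   | inj₂ eq″  = map₁ there (topmostGreater-sound A T c y eq″)

  entry-∷-same : ∀ (T : Tableau k l) i j x → entry ((i , j , x) ∷ T) i j ≡ just x
  entry-∷-same T i j x with (i ≡ᵇ i) ∧ (j ≡ᵇ j) | sameCell-reflects i j i j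
  ... | true  | _      = refl
  ... | false | ofⁿ ne = contradiction (refl , refl) ne

  entry-∷-other : ∀ (T : Tableau k l) {a b x i j} → ¬ ((i ≡ a) × (j ≡ b)) →
    entry ((a , b , x) ∷ T) i j ≡ entry T i j
  entry-∷-other T {a} {b} {i = i} {j} ne with (a ≡ᵇ i) ∧ (b ≡ᵇ j) | sameCell-reflects a b i j
  ... | true  | ofʸ (refl , refl) = contradiction (refl , refl) ne
  ... | false | _                 = refl

  setCell-∷-same : ∀ (T : Tableau k l) i j x y →
    setCell ((i , j , x) ∷ T) i j y ≡ (i , j , y) ∷ setCell T i j y
  setCell-∷-same T i j x y with (i ≡ᵇ i) ∧ (j ≡ᵇ j) | sameCell-reflects i j i j
  ... | true  | _      = refl
  ... | false | ofⁿ ne = contradiction (refl , refl) ne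

  setCell-∷-other : ∀ (T : Tableau k l) {a b x i j y} → ¬ ((i ≡ a) × (j ≡ b)) →
    setCell ((a , b , x) ∷ T) i j y ≡ (a , b , x) ∷ setCell T i j y
  setCell-∷-other T {a} {b} {i = i} {j} ne with (a ≡ᵇ i) ∧ (b ≡ᵇ j) | sameCell-reflects a b i j
  ... | true  | ofʸ (refl , refl) = contradiction (refl , refl) ne
  ... | false | _                 = refl

  entry-setCell-same : ∀ (T : Tableau k l) {i j x y} →
    entry T i j ≡ just x → entry (setCell T i j y) i j ≡ just y
  entry-setCell-same ((a , b , x′) ∷ T) {i} {j} {y = y} occupied with (i ≟ a) ×-dec (j ≟ b)
  ... | yes (refl , refl) = begin
    entry (setCell ((i , j , x′) ∷ T) i j y) i j  ≡⟨ cong (λ S → entry S i j) (setCell-∷-same T i j x′ y) ⟩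
    entry ((i , j , y) ∷ setCell T i j y) i j     ≡⟨ entry-∷-same (setCell T i j y) i j y ⟩
    just y                                        ∎
  ... | no ne = begin
    entry (setCell ((a , b , x′) ∷ T) i j y) i j  ≡⟨ cong (λ S → entry S i j) (setCell-∷-other T ne) ⟩
    entry ((a , b , x′) ∷ setCell T i j y) i j    ≡⟨ entry-∷-other (setCell T i j y) ne ⟩
    entry (setCell T i j y) i j
      ≡⟨ entry-setCell-same T (trans (sym (entry-∷-other T ne)) occupied) ⟩
    just y                                        ∎

  entry-setCell-other : ∀ (T : Tableau k l) {i j y a b} → ¬ ((a ≡ i) × (b ≡ j)) →
    entry (setCell T i j y) a b ≡ entry T a b
  entry-setCell-other [] ne = refl
  entry-setCell-other ((c , d , x′) ∷ T) {i} {j} {y} {a} {b} ne with (i ≟ c) ×-dec (j ≟ d)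
  ... | yes (refl , refl) = begin
    entry (setCell ((i , j , x′) ∷ T) i j y) a b  ≡⟨ cong (λ S → entry S a b) (setCell-∷-same T i j x′ y) ⟩
    entry ((i , j , y) ∷ setCell T i j y) a b     ≡⟨ entry-∷-other (setCell T i j y) ne ⟩
    entry (setCell T i j y) a b                   ≡⟨ entry-setCell-other T ne ⟩
    entry T a b                                   ≡⟨ entry-∷-other T ne ⟨
    entry ((i , j , x′) ∷ T) a b                  ∎
  ... | no ne′ = begin
    entry (setCell ((c , d , x′) ∷ T) i j y) a b  ≡⟨ cong (λ S → entry S a b) (setCell-∷-other T ne′) ⟩
    entry ((c , d , x′) ∷ setCell T i j y) a b
      ≡⟨ cong (if (c ≡ᵇ a) ∧ (d ≡ᵇ b) then just x′ else_) (entry-setCell-other T ne) ⟩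
    entry ((c , d , x′) ∷ T) a b                  ∎

  setCell-unoccupied : ∀ (T : Tableau k l) {i j y} → entry T i j ≡ nothing → setCell T i j y ≡ T
  setCell-unoccupied [] _ = refl
  setCell-unoccupied ((a , b , x) ∷ T) {i} {j} {y} empty with (i ≟ a) ×-dec (j ≟ b)
  ... | yes (refl , refl) = contradiction (trans (sym (entry-∷-same T i j x)) empty) λ ()
  ... | no ne = trans (setCell-∷-other T ne)
    (cong ((a , b , x) ∷_) (setCell-unoccupied T (trans (sym (entry-∷-other T ne)) empty)))

  entry-setCell-unoccupied : ∀ (T : Tableau k l) {i j y a b} →
    entry T a b ≡ nothing → entry (setCell T i j y) a b ≡ nothing
  entry-setCell-unoccupied T {i} {j} {a = a} {b} empty with (a ≟ i) ×-dec (b ≟ j)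
  ... | yes (refl , refl) = trans (cong (λ S → entry S a b) (setCell-unoccupied T empty)) empty
  ... | no ne             = trans (entry-setCell-other T ne) empty

  -- entry reads only the first triple at a position, so a cell found by a
  -- search of the list holds the entry of that position only if no position
  -- occurs twice.
  DistinctCells : Tableau k l → Set
  DistinctCells []                = ⊤
  DistinctCells ((i , j , _) ∷ T) = entry T i j ≡ nothing × DistinctCells T

  ∈⇒entry : ∀ {T : Tableau k l} {i j x} → DistinctCells T → (i , j , x) ∈ T → entry T i j ≡ just x
  ∈⇒entry {(a , b , x′) ∷ T} {i} {j} (fresh , distinct) x∈T
    with (a ≡ᵇ i) ∧ (b ≡ᵇ j) | sameCell-reflects a b i j | x∈T
  ... | true  | _                 | here refl = refl
  ... | true  | ofʸ (refl , refl) | there x∈ =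
    contradiction (trans (sym fresh) (∈⇒entry distinct x∈)) λ ()
  ... | false | ofⁿ ne            | here refl = contradiction (refl , refl) ne
  ... | false | _                 | there x∈ = ∈⇒entry distinct x∈

  distinct-setCell : ∀ (T : Tableau k l) {i j y} → DistinctCells T → DistinctCells (setCell T i j y)
  distinct-setCell [] _ = tt
  distinct-setCell ((a , b , x) ∷ T) {i} {j} {y} (fresh , distinct) with (i ≟ a) ×-dec (j ≟ b)
  ... | yes (refl , refl) = subst DistinctCells (sym (setCell-∷-same T i j x y))
    (entry-setCell-unoccupied T fresh , distinct-setCell T distinct)
  ... | no ne = subst DistinctCells (sym (setCell-∷-other T ne))
    (entry-setCell-unoccupied T fresh , distinct-setCell T distinct)

  data Update (A : Shuffle k l) (T : Tableau k l) : Tableau k l → Set where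
    overwrite : ∀ {i j x y} → entry T i j ≡ just x → y <[ A ] x → Update A T (setCell T i j y)
    extend    : ∀ {i j y} → entry T i j ≡ nothing → Update A T ((i , j , y) ∷ T)
    unchanged : Update A T T

  overwrite∈ : ∀ {A} {T : Tableau k l} {i j x y} →
    DistinctCells T → (i , j , x) ∈ T × y <[ A ] x → Update A T (setCell T i j y)
  overwrite∈ distinct (x∈T , y<x) = overwrite (∈⇒entry distinct x∈T) y<x

  step-update : ∀ A {T : Tableau k l} → DistinctCells T → ∀ τ → Update A T (proj₁ (step A T τ))
  step-update A {T} distinct (intoRow r y) with leftmostGreater A T r y in eq
  ... | nothing      = extend (entry-endOfRow T r)
  ... | just (j , x) = overwrite∈ distinct (leftmostGreater-sound A T r y eq)
  step-update A {T} distinct (intoCol c y) with topmostGreater A T c y in eq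
  ... | nothing      = extend (entry-bottomOfColumn T c)
  ... | just (i , x) = overwrite∈ distinct (topmostGreater-sound A T c y eq)

  advance-update : ∀ A (C : Config k l) → DistinctCells (tableau C) →
    Update A (tableau C) (tableau (advance A C))
  advance-update A (config T (just τ) w)      distinct = step-update A distinct τ
  advance-update A (config T nothing (x ∷ w)) distinct = step-update A distinct (initTask x)
  advance-update A (config T nothing [])      distinct = unchanged

  update-distinct : ∀ {A} {T T′ : Tableau k l} → DistinctCells T → Update A T T′ → DistinctCells T′
  update-distinct {T = T} distinct (overwrite _ _) = distinct-setCell T distinct
  update-distinct distinct (extend empty)  = empty , distinct
  update-distinct distinct unchanged       = distinct

  distinct-Pstep : ∀ {n} A (v : Vec (Letter k l) n) p → DistinctCells (Pstep A v p)
  distinct-Pstep A v zero    = tt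
  distinct-Pstep A v (suc p) =
    update-distinct (distinct-Pstep A v p) (advance-update A (configAfter A v p) (distinct-Pstep A v p))

  Pstep-update : ∀ {n} A (v : Vec (Letter k l) n) p → Update A (Pstep A v p) (Pstep A v (suc p))
  Pstep-update A v p = advance-update A (configAfter A v p) (distinct-Pstep A v p)

  data Descends (A : Shuffle k l) : Maybe (Letter k l) → Maybe (Letter k l) → Set where
    stays-empty : Descends A nothing nothing
    created     : ∀ {z} → Descends A nothing (just z)
    lowered     : ∀ {w z} → z ≤[ A ] w → Descends A (just w) (just z)

  ≡⇒descends : ∀ {A} {o o′ : Maybe (Letter k l)} → o′ ≡ o → Descends A o o′
  ≡⇒descends {o = nothing} refl = stays-empty
  ≡⇒descends {o = just _}  refl = lowered ≤-refl

  update-descends : ∀ {A} {T T′ : Tableau k l} → Update A T T′ →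
    ∀ r s → Descends A (entry T r s) (entry T′ r s)
  update-descends {A = A} {T} (overwrite {i} {j} occupied y<x) r s with (r ≟ i) ×-dec (s ≟ j)
  ... | yes (refl , refl) =
    subst₂ (Descends A) (sym occupied) (sym (entry-setCell-same T occupied)) (lowered (<⇒≤ y<x))
  ... | no ne = ≡⇒descends (entry-setCell-other T ne)
  update-descends {A = A} {T} (extend {i} {j} {y} empty) r s with (r ≟ i) ×-dec (s ≟ j)
  ... | yes (refl , refl) = subst₂ (Descends A) (sym empty) (sym (entry-∷-same T r s y)) created
  ... | no ne = ≡⇒descends (entry-∷-other T ne)
  update-descends unchanged r s = ≡⇒descends refl

  descends⇒entryBounds : ∀ {A} {o o′ : Maybe (Letter k l)} → Descends A o o′ →
    (∀ w → o ≡ just w → ∃ λ z → o′ ≡ just z × z ≤[ A ] w)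
    × (∀ z → o′ ≡ just z → o ≡ nothing ⊎ ∃ λ w → o ≡ just w × z ≤[ A ] w)
  descends⇒entryBounds stays-empty   = (λ _ ()) , (λ _ ())
  descends⇒entryBounds created       = (λ _ ()) , (λ _ _ → inj₁ refl)
  descends⇒entryBounds (lowered z≤w) =
    (λ { _ refl → _ , refl , z≤w }) , (λ { _ refl → inj₂ (_ , refl , z≤w) })

lemma2p14 : ∀ {k l n} (A : Shuffle k l) (v : Vec (Letter k l) n) (q : ℕ) →
    1 ≤ q → StepPerformed A v (suc q) →
    ∀ (r s : ℕ) → 1 ≤ r → 1 ≤ s →
      (∀ w → entry (Pstep A v q) r s ≡ just w →
        ∃ λ z → entry (Pstep A v (suc q)) r s ≡ just z × z ≤[ A ] w)
      × (∀ z → entry (Pstep A v (suc q)) r s ≡ just z →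
        entry (Pstep A v q) r s ≡ nothing
        ⊎ ∃ λ w → entry (Pstep A v q) r s ≡ just w × z ≤[ A ] w)
lemma2p14 A v q _ _ r s _ _ = descends⇒entryBounds (update-descends (Pstep-update A v q) r s)
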